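{- Let $\overline{\mathcal{S}}$ be the set of strict overpartitions: partitions $\lambda=(\lambda_1>\cdots>\lambda_\ell)$ into distinct positive parts in which a part $\lambda_i$ may be overlined only if $\lambda_i\ge2$ and $\lambda_i-\lambda_{i+1}\ge2$ (with $\lambda_{\ell+1}:=0$); the empty partition is included. Then $$\sum_{\lambda\in\overline{\mathcal{S}}}a^{\overline{\#}(\lambda)}q^{|\lambda|}=\sum_{n=0}^{\infty}\frac{(-aq;q)_{n}}{(q;q)_{n}}q^{\frac{n(n+1)}{2}}=(-aq^2;q^2)_{\infty}(-q;q)_{\infty}.$$
   Context: $\overline{\#}(\lambda)$ is the number of overlined parts and $|\lambda|$ the sum of the parts (ignoring overlines). $(a;q)_n=\prod_{i=0}^{n-1}(1-aq^i)$ for $n\in\mathbb{Z}_{\ge0}\cup\{\infty\}$, $|q|<1$. -}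

module Defs where

open import Data.Nat using (ℕ; zero; suc; _+_; _*_; _∸_; _≤_; _<_)
open import Data.Nat.DivMod using (_/_)
open import Data.Nat.Divisibility using (_∣?_)
open import Data.Nat.Properties using (_≟_)
open import Data.Bool using (Bool; true; false; if_then_else_; _∧_)
open import Data.Integer using (ℤ; 0ℤ; 1ℤ) renaming (_+_ to _+ℤ_; _*_ to _*ℤ_)
open import Data.List using (List; []; _∷_)
open import Data.Product using (Σ; _×_; _,_)
open import Data.Unit using (⊤)
open import Relation.Nullary.Decidable using (⌊_⌋)
open import Relation.Binary.PropositionalEquality using (_≡_)

-- Strict overpartitions.
-- A partition is a list of (part , overlined?) pairs, largest part first.

next : List (ℕ × Bool) → ℕ
next [] = 0
next ((p , _) ∷ _) = p

overlineOK : ℕ → Bool → ℕ → Set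
overlineOK p false nx = ⊤
overlineOK p true  nx = (2 ≤ p) × (2 ≤ p ∸ nx)

IsStrictOverpartition : List (ℕ × Bool) → Set
IsStrictOverpartition [] = ⊤
IsStrictOverpartition ((p , o) ∷ rest) =
  (1 ≤ p) × (next rest < p) × overlineOK p o (next rest) × IsStrictOverpartition rest

size : List (ℕ × Bool) → ℕ
size [] = 0
size ((p , _) ∷ rest) = p + size rest

numOverlined : List (ℕ × Bool) → ℕ
numOverlined [] = 0
numOverlined ((_ , true) ∷ rest) = suc (numOverlined rest)
numOverlined ((_ , false) ∷ rest) = numOverlined rest

SOP : ℕ → ℕ → Set
SOP k N = Σ (List (ℕ × Bool)) λ l →
  IsStrictOverpartition l × (size l ≡ N) × (numOverlined l ≡ k)

-- Formal power series in a and q with integer coefficients: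
-- f k N = coefficient of a^k q^N.

Ser : Set
Ser = ℕ → ℕ → ℤ

sumBelow : ℕ → (ℕ → ℤ) → ℤ
sumBelow zero f = 0ℤ
sumBelow (suc n) f = sumBelow n f +ℤ f n

_⊕_ : Ser → Ser → Ser
(f ⊕ g) k N = f k N +ℤ g k N

_⊗_ : Ser → Ser → Ser
(f ⊗ g) k N = sumBelow (suc k) λ i → sumBelow (suc N) λ j →
  f i j *ℤ g (k ∸ i) (N ∸ j)

one : Ser
one zero zero = 1ℤ
one _ _ = 0ℤ

mono : ℕ → ℕ → Ser
mono e m k N = if ⌊ k ≟ e ⌋ ∧ ⌊ N ≟ m ⌋ then 1ℤ else 0ℤ

invOneMinusQ^suc : ℕ → Ser
invOneMinusQ^suc d zero N = if ⌊ suc d ∣? N ⌋ then 1ℤ else 0ℤ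
invOneMinusQ^suc d (suc _) N = 0ℤ

prodBelow : ℕ → (ℕ → Ser) → Ser
prodBelow zero F = one
prodBelow (suc n) F = prodBelow n F ⊗ F n

negAQPoch : ℕ → Ser
negAQPoch n = prodBelow n λ i → one ⊕ mono 1 (suc i)

invQPoch : ℕ → Ser
invQPoch n = prodBelow n invOneMinusQ^suc

middleTerm : ℕ → Ser
middleTerm n = (negAQPoch n ⊗ invQPoch n) ⊗ mono 0 ((n * suc n) / 2)

-- coefficient of a^k q^N in Σ_{n≥0} middleTerm n; summands with
-- n > N have q-order n(n+1)/2 > N, so only n ≤ N contribute.
middleSeries : Ser
middleSeries k N = sumBelow (suc N) λ n → middleTerm n k N

-- coefficient of a^k q^N in (-aq²;q²)_∞ (-q;q)_∞; factors with index
-- i ≥ N have q-degree > N, so truncating to N factors is exact.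
productSide : Ser
productSide k N =
  ((prodBelow N λ i → one ⊕ mono 1 (2 * suc i)) ⊗
   (prodBelow N λ i → one ⊕ mono 0 (suc i))) k N

-- A strict overpartition λ₁ > ⋯ > λ_ℓ is determined by its gaps λᵢ − λᵢ₊₁ = 1 + oᵢ + zᵢ, where oᵢ ∈ {0,1}
-- records whether λᵢ is overlined and zᵢ ≥ 0. As |λ| = Σᵢ i (1 + oᵢ + zᵢ), the strict overpartitions with ℓ
-- parts are counted by q^{ℓ(ℓ+1)/2} (−aq;q)_ℓ / (q;q)_ℓ, the ℓ-th term of the middle sum.
--
-- For the product, draw λ as a column of cells in which a part occupies the cell of its size and an overlined
-- part also the cell below. Deleting the cells of the plain parts leaves the k overlined ones as a partition μ
-- into parts differing by at least 2, the smallest at least 2; collapsing each overlined part to one empty cell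
-- leaves the plain ones as a partition β into distinct parts; and |λ| = |μ| + |β| + k·ℓ(β). Writing the gaps
-- of μ as 2 + 2eᵢ + δᵢ with δᵢ ∈ {0,1} gives |μ| = 2|ν| + Σᵢ i δᵢ for a partition ν into k distinct parts,
-- while {βⱼ + k} ∪ {i : δᵢ = 1} is a partition into distinct parts of |β| + k·ℓ(β) + Σᵢ i δᵢ. Pairs of
-- partitions into distinct parts, the first counted twice and weighted by a, are what (−aq²;q²)_∞ (−q;q)_∞
-- counts.
--
-- Both identities are proved coefficientwise: each coefficient is exhibited as the cardinality of a finite
-- set, products of series becoming Cartesian products and sums disjoint unions.

module Submission where

open import Defs
open import Data.Bool using (Bool; true; false)
open import Data.Empty using (⊥-elim)
open import Data.Fin using (Fin)
open import Data.Fin.Permutation using (↔⇒≡)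
open import Data.Fin.Properties using (0↔⊥; 1↔⊤; +↔⊎; *↔×)
open import Data.Integer using (ℤ) renaming (+_ to pos; _+_ to _+ℤ_; _*_ to _*ℤ_)
import Data.Integer.Properties as ℤ
open import Data.List using (List; []; _∷_; _++_; map; length; replicate; reverse; take; drop; zip; unzip)
open import Data.List.Properties
  using (length-++; length-replicate; length-take; length-drop; take++drop≡id; length-zipWith; length-unzipWith₁;
         length-unzipWith₂; zip-unzip; unzip-zip; length-reverse; reverse-involutive; reverse-map; unfold-reverse)
open import Data.List.Relation.Binary.Permutation.Propositional.Properties using (↭-reverse)
open import Data.Maybe using (Maybe; just; nothing; is-just; maybe)
open import Data.Nat using (ℕ; zero; suc; _+_; _*_; _∸_; _⊓_; _≤_; _<_; z≤n; s≤s)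
open import Data.Nat.DivMod using (_/_; m*n/n≡m)
open import Data.Nat.Divisibility using (divides; _∣?_)
open import Data.Nat.ListAction using (sum)
open import Data.Nat.ListAction.Properties using (sum-↭)
open import Data.Nat.Properties
open import Data.Nat.Tactic.RingSolver using (solve-∀)
open import Data.Product using (Σ; _×_; _,_; proj₁; proj₂)
open import Data.Product.Function.NonDependent.Propositional using (_×-↔_)
open import Data.Sum using (_⊎_; inj₁; inj₂; [_,_])
open import Data.Sum.Function.Propositional using (_⊎-↔_)
open import Data.Unit using (⊤; tt)
open import Function using (_∘_; const; id)
open import Function.Bundles using (_↔_; mk↔ₛ′; Inverse)
open import Function.Properties.Inverse using (↔-sym; ↔-trans)
open import Function.Related.Propositional using (module EquationalReasoning)
open import Relation.Binary.PropositionalEquality hiding ([_])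
open import Relation.Nullary using (¬_; yes; no; Irrelevant)
import Relation.Unary as U

private variable
  A B : Set

open Inverse using (to; from; strictlyInverseˡ; strictlyInverseʳ)

-- Finite sets of a given integer cardinality

×-irrelevant : Irrelevant A → Irrelevant B → Irrelevant (A × B)
×-irrelevant irrA irrB (a , b) (a′ , b′) = cong₂ _,_ (irrA a a′) (irrB b b′)

subset-≡ : {P : A → Set} → U.Irrelevant P → ∀ {a a′} {p : P a} {p′ : P a′} → a ≡ a′ → (a , p) ≡ (a′ , p′)
subset-≡ irrP refl = cong (_ ,_) (irrP _ _)

subset-↔ : {P : A → Set} {Q : B → Set} → U.Irrelevant P → U.Irrelevant Q →
           (f : A → B) (g : B → A) → (∀ {a} → P a → Q (f a)) → (∀ {b} → Q b → P (g b)) →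
           (∀ {b} → Q b → f (g b) ≡ b) → (∀ {a} → P a → g (f a) ≡ a) →
           Σ A P ↔ Σ B Q
subset-↔ irrP irrQ f g f-resp g-resp f∘g g∘f = mk↔ₛ′
  (λ (a , p) → f a , f-resp p) (λ (b , q) → g b , g-resp q)
  (λ (b , q) → subset-≡ irrQ (f∘g q)) (λ (a , p) → subset-≡ irrP (g∘f p))

Card : Set → ℤ → Set
Card A z = Σ ℕ λ c → (Fin c ↔ A) × (z ≡ pos c)

Card-↔ : A ↔ B → ∀ {z} → Card A z → Card B z
Card-↔ A↔B (c , Fin↔A , z≡c) = c , ↔-trans Fin↔A A↔B , z≡c

Card-empty : ¬ A → Card A (pos 0)
Card-empty ¬a = 0 , ↔-trans 0↔⊥ (mk↔ₛ′ (λ ()) ¬a (λ a → ⊥-elim (¬a a)) (λ ())) , refl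

Card-singleton : (a : A) → (∀ a′ → a′ ≡ a) → Card A (pos 1)
Card-singleton a unique = 1 , ↔-trans 1↔⊤ (mk↔ₛ′ (const a) (const tt) (λ a′ → sym (unique a′)) (λ _ → refl)) , refl

Card-⊎ : ∀ {z w} → Card A z → Card B w → Card (A ⊎ B) (z +ℤ w)
Card-⊎ (c , Fin↔A , refl) (d , Fin↔B , refl) =
  c + d , ↔-trans +↔⊎ (Fin↔A ⊎-↔ Fin↔B) , sym (ℤ.pos-+ c d)

Card-× : ∀ {z w} → Card A z → Card B w → Card (A × B) (z *ℤ w)
Card-× (c , Fin↔A , refl) (d , Fin↔B , refl) =
  c * d , ↔-trans *↔× (Fin↔A ×-↔ Fin↔B) , sym (ℤ.pos-* c d)

Card-unique : ∀ {z w} → Card A z → Card A w → z ≡ w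
Card-unique (c , Fin↔A , refl) (d , Fin↔A′ , refl) = cong pos (↔⇒≡ (↔-trans Fin↔A (↔-sym Fin↔A′)))

Below : ℕ → (ℕ → Set) → Set
Below n P = Σ ℕ λ i → i < n × P i

Below-suc-↔ : ∀ n {P} → Below (suc n) P ↔ (Below n P ⊎ P n)
Below-suc-↔ n {P} = mk↔ₛ′ split join split∘join join∘split
  where
  split : Below (suc n) P → Below n P ⊎ P n
  split (i , i<1+n , p) with i <? n
  ... | yes i<n = inj₁ (i , i<n , p)
  ... | no  i≮n = inj₂ (subst P (≤-antisym (≤-pred i<1+n) (≮⇒≥ i≮n)) p)
  join : Below n P ⊎ P n → Below (suc n) P
  join (inj₁ (i , i<n , p)) = i , m≤n⇒m≤1+n i<n , p
  join (inj₂ p)             = n , ≤-refl , p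
  split∘join : ∀ x → split (join x) ≡ x
  split∘join (inj₁ (i , i<n , p)) with i <? n
  ... | yes _   = cong (λ i<n → inj₁ (i , i<n , p)) (<-irrelevant _ _)
  ... | no  i≮n = ⊥-elim (i≮n i<n)
  split∘join (inj₂ p) with n <? n
  ... | yes n<n = ⊥-elim (<-irrefl refl n<n)
  ... | no  _   = cong (λ n≡n → inj₂ (subst P n≡n p)) (≡-irrelevant _ refl)
  join∘split : ∀ x → join (split x) ≡ x
  join∘split (i , i<1+n , p) with i <? n
  ... | yes _ = cong (λ i< → i , i< , p) (<-irrelevant _ _)
  ... | no i≮n with ≤-antisym (≤-pred i<1+n) (≮⇒≥ i≮n)
  ...   | refl = cong (λ i< → i , i< , p) (<-irrelevant _ _)

Card-Below : ∀ n {P z} → (∀ i → Card (P i) (z i)) → Card (Below n P) (sumBelow n z)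
Card-Below zero    card = Card-empty λ ()
Card-Below (suc n) card = Card-↔ (↔-sym (Below-suc-↔ n)) (Card-⊎ (Card-Below n card) (card n))

-- Coefficients of series as cardinalities of graded sets

-- The elements x of A of weight a^k q^N, where x has weight a^(α x) q^(β x).
Graded : (A : Set) → (A → ℕ) → (A → ℕ) → ℕ → ℕ → Set
Graded A α β k N = Σ A λ a → α a ≡ k × β a ≡ N

≡×≡-irrelevant : ∀ {m n k N : ℕ} → Irrelevant (m ≡ k × n ≡ N)
≡×≡-irrelevant = ×-irrelevant ≡-irrelevant ≡-irrelevant

Graded-↔ : ∀ {α β : A → ℕ} {α′ β′ : B → ℕ} (e : A ↔ B) →
           (∀ a → α′ (to e a) ≡ α a) → (∀ a → β′ (to e a) ≡ β a) →
           ∀ {k N} → Graded A α β k N ↔ Graded B α′ β′ k N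
Graded-↔ {α = α} {β} {α′} {β′} e α-resp β-resp =
  subset-↔ ≡×≡-irrelevant ≡×≡-irrelevant
  (to e) (from e)
  (λ {a} (α≡k , β≡N) → trans (α-resp a) α≡k , trans (β-resp a) β≡N)
  (λ {b} (α≡k , β≡N) → trans (sym (α-resp (from e b))) (trans (cong α′ (strictlyInverseˡ e b)) α≡k)
                     , trans (sym (β-resp (from e b))) (trans (cong β′ (strictlyInverseˡ e b)) β≡N))
  (λ {b} _ → strictlyInverseˡ e b) (λ {a} _ → strictlyInverseʳ e a)

Graded-⊎-↔ : ∀ {α β : A → ℕ} {α′ β′ : B → ℕ} {k N} →
             (Graded A α β k N ⊎ Graded B α′ β′ k N) ↔ Graded (A ⊎ B) [ α , α′ ] [ β , β′ ] k N
Graded-⊎-↔ = mk↔ₛ′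
  (λ { (inj₁ (a , w)) → inj₁ a , w ; (inj₂ (b , w)) → inj₂ b , w })
  (λ { (inj₁ a , w) → inj₁ (a , w) ; (inj₂ b , w) → inj₂ (b , w) })
  (λ { (inj₁ a , w) → refl ; (inj₂ b , w) → refl })
  (λ { (inj₁ (a , w)) → refl ; (inj₂ (b , w)) → refl })

Graded-×-↔ : ∀ {α β : A → ℕ} {α′ β′ : B → ℕ} {k N} →
  Below (suc k) (λ i → Below (suc N) λ j → Graded A α β i j × Graded B α′ β′ (k ∸ i) (N ∸ j)) ↔
  Graded (A × B) (λ (a , b) → α a + α′ b) (λ (a , b) → β a + β′ b) k N
Graded-×-↔ {A = A} {B} {α} {β} {α′} {β′} {k} {N} = mk↔ₛ′ join split join∘split split∘join
  where
  Convolution : Set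
  Convolution = Below (suc k) (λ i → Below (suc N) λ j → Graded A α β i j × Graded B α′ β′ (k ∸ i) (N ∸ j))
  join : Convolution → Graded (A × B) _ _ k N
  join (i , i<1+k , j , j<1+N , (a , refl , refl) , (b , α′≡ , β′≡)) =
    (a , b) , trans (cong (α a +_) α′≡) (m+[n∸m]≡n (≤-pred i<1+k))
            , trans (cong (β a +_) β′≡) (m+[n∸m]≡n (≤-pred j<1+N))
  split : Graded (A × B) _ _ k N → Convolution
  split ((a , b) , α≡k , β≡N) =
    α a , s≤s (≤-trans (m≤m+n _ _) (≤-reflexive α≡k)) , β a , s≤s (≤-trans (m≤m+n _ _) (≤-reflexive β≡N)) ,
    (a , refl , refl) , (b , trans (sym (m+n∸m≡n (α a) (α′ b))) (cong (_∸ α a) α≡k)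
                           , trans (sym (m+n∸m≡n (β a) (β′ b))) (cong (_∸ β a) β≡N))
  join∘split : ∀ x → join (split x) ≡ x
  join∘split ((a , b) , _) = cong ((a , b) ,_) (≡×≡-irrelevant _ _)
  split∘join : ∀ x → split (join x) ≡ x
  split∘join (i , i<1+k , j , j<1+N , (a , refl , refl) , (b , _)) =
    cong₂ (λ (i<1+k , j<1+N) weights → α a , i<1+k , β a , j<1+N , (a , refl , refl) , (b , weights))
          (×-irrelevant <-irrelevant <-irrelevant _ _) (≡×≡-irrelevant _ _)

Counts : Ser → (ℕ → ℕ → Set) → Set
Counts f X = ∀ k N → Card (X k N) (f k N)

Counts-↔ : ∀ {f X Y} → (∀ {k N} → X k N ↔ Y k N) → Counts f X → Counts f Y
Counts-↔ X↔Y counts k N = Card-↔ X↔Y (counts k N)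

Counts-mono : ∀ e m → Counts (mono e m) (Graded ⊤ (const e) (const m))
Counts-mono e m k N with k ≟ e | N ≟ m
... | yes refl | yes refl = Card-singleton (tt , refl , refl) (λ _ → subset-≡ ≡×≡-irrelevant refl)
... | yes _    | no N≢m   = Card-empty (λ (_ , _ , m≡N) → N≢m (sym m≡N))
... | no k≢e   | _        = Card-empty (λ (_ , e≡k , _) → k≢e (sym e≡k))

one≗mono-0-0 : ∀ k N → one k N ≡ mono 0 0 k N
one≗mono-0-0 zero    zero    = refl
one≗mono-0-0 zero    (suc N) = refl
one≗mono-0-0 (suc k) N       = refl

Counts-one : Counts one (Graded ⊤ (const 0) (const 0))
Counts-one k N = subst (Card _) (sym (one≗mono-0-0 k N)) (Counts-mono 0 0 k N)

Counts-⊕ : ∀ {f g} {α β : A → ℕ} {α′ β′ : B → ℕ} →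
           Counts f (Graded A α β) → Counts g (Graded B α′ β′) →
           Counts (f ⊕ g) (Graded (A ⊎ B) [ α , α′ ] [ β , β′ ])
Counts-⊕ counts-f counts-g k N = Card-↔ Graded-⊎-↔ (Card-⊎ (counts-f k N) (counts-g k N))

Counts-⊗ : ∀ {f g} {α β : A → ℕ} {α′ β′ : B → ℕ} →
           Counts f (Graded A α β) → Counts g (Graded B α′ β′) →
           Counts (f ⊗ g) (Graded (A × B) (λ (a , b) → α a + α′ b) (λ (a , b) → β a + β′ b))
Counts-⊗ counts-f counts-g k N = Card-↔ Graded-×-↔
  (Card-Below (suc k) λ i → Card-Below (suc N) λ j → Card-× (counts-f i j) (counts-g (k ∸ i) (N ∸ j)))

Counts-invOneMinusQ^suc : ∀ d → Counts (invOneMinusQ^suc d) (Graded ℕ (const 0) (suc d *_))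
Counts-invOneMinusQ^suc d (suc k) N = Card-empty λ { (_ , () , _) }
Counts-invOneMinusQ^suc d zero    N with suc d ∣? N
... | yes (divides j N≡j*d) = Card-singleton (j , refl , trans (*-comm (suc d) j) (sym N≡j*d))
        (λ (j′ , d*j′≡N) → subset-≡ ≡×≡-irrelevant
           (*-cancelˡ-≡ j′ j (suc d) (trans (proj₂ d*j′≡N) (trans N≡j*d (*-comm j (suc d))))))
... | no  d∤N = Card-empty (λ (j , _ , d*j≡N) → d∤N (divides j (trans (sym d*j≡N) (*-comm (suc d) j))))

-- Weighted sums over lists and bit words

-- Lists rather than vectors, so that reverse, _++_, take and drop need no index casts.
ListOfLength : Set → ℕ → Set
ListOfLength A n = Σ (List A) λ l → length l ≡ n

total : (A → ℕ) → List A → ℕ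
total w l = sum (map w l)

rankSumʳ : (A → ℕ) → List A → ℕ
rankSumʳ w []      = 0
rankSumʳ w (a ∷ l) = suc (length l) * w a + rankSumʳ w l

rankSumˡ : (A → ℕ) → List A → ℕ
rankSumˡ w []      = 0
rankSumˡ w (a ∷ l) = w a + total w l + rankSumˡ w l

total-reverse : ∀ (w : A → ℕ) l → total w (reverse l) ≡ total w l
total-reverse w l = trans (cong sum (reverse-map w l)) (sum-↭ (↭-reverse (map w l)))

rankSumʳ-++ : ∀ (w : A → ℕ) l l′ → rankSumʳ w (l ++ l′) ≡ rankSumʳ w l + length l′ * total w l + rankSumʳ w l′
rankSumʳ-++ w []      l′ = cong (_+ rankSumʳ w l′) (sym (*-zeroʳ (length l′)))
rankSumʳ-++ w (a ∷ l) l′ = begin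
  suc (length (l ++ l′)) * w a + rankSumʳ w (l ++ l′)
    ≡⟨ cong₂ (λ m r → suc m * w a + r) (length-++ l) (rankSumʳ-++ w l l′) ⟩
  suc (length l + length l′) * w a + (rankSumʳ w l + length l′ * total w l + rankSumʳ w l′)
    ≡⟨ rearrange (length l) (length l′) (w a) (rankSumʳ w l) (total w l) (rankSumʳ w l′) ⟩
  suc (length l) * w a + rankSumʳ w l + length l′ * (w a + total w l) + rankSumʳ w l′ ∎
  where
  open ≡-Reasoning
  rearrange : ∀ m m′ x r t r′ → suc (m + m′) * x + (r + m′ * t + r′) ≡ suc m * x + r + m′ * (x + t) + r′
  rearrange = solve-∀

rankSumʳ-reverse : ∀ (w : A → ℕ) l → rankSumʳ w (reverse l) ≡ rankSumˡ w l
rankSumˡ-reverse : ∀ (w : A → ℕ) l → rankSumˡ w (reverse l) ≡ rankSumʳ w l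

rankSumʳ-reverse w []      = refl
rankSumʳ-reverse w (a ∷ l) = begin
  rankSumʳ w (reverse (a ∷ l))
    ≡⟨ cong (rankSumʳ w) (unfold-reverse a l) ⟩
  rankSumʳ w (reverse l ++ a ∷ [])
    ≡⟨ rankSumʳ-++ w (reverse l) (a ∷ []) ⟩
  rankSumʳ w (reverse l) + 1 * total w (reverse l) + (1 * w a + 0)
    ≡⟨ cong₂ (λ r t → r + 1 * t + (1 * w a + 0)) (rankSumʳ-reverse w l) (total-reverse w l) ⟩
  rankSumˡ w l + 1 * total w l + (1 * w a + 0)
    ≡⟨ rearrange (rankSumˡ w l) (total w l) (w a) ⟩
  rankSumˡ w (a ∷ l) ∎
  where
  open ≡-Reasoning
  rearrange : ∀ r t x → r + 1 * t + (1 * x + 0) ≡ x + t + r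
  rearrange = solve-∀

rankSumˡ-reverse w l = begin
  rankSumˡ w (reverse l)                     ≡⟨ rankSumʳ-reverse w (reverse l) ⟨
  rankSumʳ w (reverse (reverse l))           ≡⟨ cong (rankSumʳ w) (reverse-involutive l) ⟩
  rankSumʳ w l                               ∎
  where open ≡-Reasoning

total-zero : ∀ (l : List A) → total (const 0) l ≡ 0
total-zero []      = refl
total-zero (_ ∷ l) = total-zero l

total-suc : ∀ (w : A → ℕ) l → total (suc ∘ w) l ≡ length l + total w l
total-suc w []      = refl
total-suc w (a ∷ l) = trans (cong (suc (w a) +_) (total-suc w l)) (cong suc (rearrange (w a) (length l) (total w l)))
  where
  rearrange : ∀ x m t → x + (m + t) ≡ m + (x + t)
  rearrange = solve-∀

total≤rankSumʳ : ∀ (w : A → ℕ) l → total w l ≤ rankSumʳ w l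
total≤rankSumʳ w []      = z≤n
total≤rankSumʳ w (a ∷ l) = +-mono-≤ (m≤n*m (w a) (suc (length l))) (total≤rankSumʳ w l)

total≤rankSumˡ : ∀ (w : A → ℕ) l → total w l ≤ rankSumˡ w l
total≤rankSumˡ w []      = z≤n
total≤rankSumˡ w (a ∷ l) = m≤m+n (w a + total w l) (rankSumˡ w l)

total-blanks-++ : ∀ (w : A → ℕ) t x l → total w (replicate t x ++ l) ≡ t * w x + total w l
total-blanks-++ w zero    x l = refl
total-blanks-++ w (suc t) x l = trans (cong (w x +_) (total-blanks-++ w t x l)) (sym (+-assoc (w x) _ _))

rankSumʳ-scale : ∀ c (w : A → ℕ) l → rankSumʳ (λ a → c * w a) l ≡ c * rankSumʳ w l
rankSumʳ-scale c w []      = sym (*-zeroʳ c)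
rankSumʳ-scale c w (a ∷ l) = trans (cong (suc (length l) * (c * w a) +_) (rankSumʳ-scale c w l))
                                   (rearrange (suc (length l)) c (w a) (rankSumʳ w l))
  where
  rearrange : ∀ m c x r → m * (c * x) + c * r ≡ c * (m * x + r)
  rearrange = solve-∀

rankSumʳ-one : ∀ (l : List A) → rankSumʳ (const 1) l * 2 ≡ length l * suc (length l)
rankSumʳ-one []      = refl
rankSumʳ-one (a ∷ l) = begin
  (suc (length l) * 1 + rankSumʳ (const 1) l) * 2   ≡⟨ *-distribʳ-+ 2 (suc (length l) * 1) _ ⟩
  suc (length l) * 1 * 2 + rankSumʳ (const 1) l * 2 ≡⟨ cong (suc (length l) * 1 * 2 +_) (rankSumʳ-one l) ⟩
  suc (length l) * 1 * 2 + length l * suc (length l) ≡⟨ rearrange (length l) ⟩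
  suc (length l) * suc (suc (length l))             ∎
  where
  open ≡-Reasoning
  rearrange : ∀ m → suc m * 1 * 2 + m * suc m ≡ suc m * suc (suc m)
  rearrange = solve-∀

triangle : ∀ (l : List A) → (length l * suc (length l)) / 2 ≡ rankSumʳ (const 1) l
triangle l = trans (cong (_/ 2) (sym (rankSumʳ-one l))) (m*n/n≡m (rankSumʳ (const 1) l) 2)

length-zip : ∀ (as : List A) (bs : List B) → length as ≡ length bs → length (zip as bs) ≡ length as
length-zip as bs |as|≡|bs| = trans (length-zipWith _,_ as bs) (trans (cong (length as ⊓_) (sym |as|≡|bs|)) (⊓-idem _))

zip-↔ : ∀ {n} → (ListOfLength A n × ListOfLength B n) ↔ ListOfLength (A × B) n
zip-↔ = mk↔ₛ′
  (λ ((as , |as|≡n) , (bs , |bs|≡n)) → zip as bs , trans (length-zip as bs (trans |as|≡n (sym |bs|≡n))) |as|≡n)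
  (λ (abs , |abs|≡n) → (proj₁ (unzip abs) , trans (length-unzipWith₁ id abs) |abs|≡n)
                     , (proj₂ (unzip abs) , trans (length-unzipWith₂ id abs) |abs|≡n))
  (λ (abs , _) → subset-≡ ≡-irrelevant (zip-unzip abs))
  (λ ((as , |as|≡n) , (bs , |bs|≡n)) → let as,bs≡ = unzip-zip as bs (trans |as|≡n (sym |bs|≡n)) in
     cong₂ _,_ (subset-≡ ≡-irrelevant (cong proj₁ as,bs≡)) (subset-≡ ≡-irrelevant (cong proj₂ as,bs≡)))

reverse-↔ : ∀ {n} → ListOfLength A n ↔ ListOfLength A n
reverse-↔ = mk↔ₛ′ reverse′ reverse′ reverse′-involutive reverse′-involutive
  where
  reverse′ : ∀ {n} → ListOfLength A n → ListOfLength A n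
  reverse′ (l , |l|≡n) = reverse l , trans (length-reverse l) |l|≡n
  reverse′-involutive : ∀ {n} (x : ListOfLength A n) → reverse′ (reverse′ x) ≡ x
  reverse′-involutive (l , _) = subset-≡ ≡-irrelevant (reverse-involutive l)

take-length-++ : ∀ (B l : List A) → take (length B) (B ++ l) ≡ B
take-length-++ []      l = refl
take-length-++ (b ∷ B) l = cong (b ∷_) (take-length-++ B l)

drop-length-++ : ∀ (B l : List A) → drop (length B) (B ++ l) ≡ l
drop-length-++ []      l = refl
drop-length-++ (b ∷ B) l = drop-length-++ B l

Counts-prodBelow : ∀ {F} (α β : A → ℕ) → (∀ i → Counts (F i) (Graded A α (λ a → suc i * β a))) →
                   ∀ n → Counts (prodBelow n F) (Graded (ListOfLength A n) (total α ∘ proj₁) (rankSumʳ β ∘ proj₁))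
Counts-prodBelow {A = A} α β counts-F zero = Counts-↔ (Graded-↔ nil-↔ (const refl) (const refl)) Counts-one
  where
  nil-↔ : ⊤ ↔ ListOfLength A 0
  nil-↔ = mk↔ₛ′ (const ([] , refl)) (const tt) (λ { ([] , refl) → refl }) (λ _ → refl)
Counts-prodBelow {A = A} α β counts-F (suc n) =
  Counts-↔ (Graded-↔ cons-↔ (λ ((l , _) , a) → +-comm (α a) (total α l)) resp-β)
           (Counts-⊗ (Counts-prodBelow α β counts-F n) (counts-F n))
  where
  cons-↔ : (ListOfLength A n × A) ↔ ListOfLength A (suc n)
  cons-↔ = mk↔ₛ′ (λ ((l , |l|≡n) , a) → a ∷ l , cong suc |l|≡n)
                 (λ { (a ∷ l , |a∷l|≡1+n) → (l , suc-injective |a∷l|≡1+n) , a })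
                 (λ { (a ∷ l , _) → subset-≡ ≡-irrelevant refl })
                 (λ ((l , _) , a) → cong (_, a) (subset-≡ ≡-irrelevant refl))
  resp-β : ∀ (((l , _) , a) : ListOfLength A n × A) → rankSumʳ β (a ∷ l) ≡ rankSumʳ β l + suc n * β a
  resp-β ((l , refl) , a) = +-comm (suc (length l) * β a) (rankSumʳ β l)

Bit : Set
Bit = Maybe ⊤

pattern ○ = nothing
pattern ● = just tt

∣_∣ : Bit → ℕ
∣ ○ ∣ = 0
∣ ● ∣ = 1

ones : List Bit → ℕ
ones = total ∣_∣

zeros : List Bit → ℕ
zeros = total (λ b → 1 ∸ ∣ b ∣)

-- The sum of the distinct parts i such that the i-th letter from the right end is ●.
σ : List Bit → ℕ
σ = rankSumʳ ∣_∣

length≡zeros+ones : ∀ B → length B ≡ zeros B + ones B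
length≡zeros+ones []      = refl
length≡zeros+ones (○ ∷ B) = cong suc (length≡zeros+ones B)
length≡zeros+ones (● ∷ B) = trans (cong suc (length≡zeros+ones B)) (sym (+-suc _ _))

ones≤length : ∀ l → ones l ≤ length l
ones≤length []      = z≤n
ones≤length (○ ∷ l) = m≤n⇒m≤1+n (ones≤length l)
ones≤length (● ∷ l) = s≤s (ones≤length l)

bits-blanks-++ : ∀ (f : List Bit → ℕ) → (∀ l → f (○ ∷ l) ≡ f l) → ∀ t l → f (replicate t ○ ++ l) ≡ f l
bits-blanks-++ f blank-invisible zero    l = refl
bits-blanks-++ f blank-invisible (suc t) l = trans (blank-invisible _) (bits-blanks-++ f blank-invisible t l)

σ-++-reverse : ∀ B ds → σ (B ++ reverse ds) ≡ σ B + length ds * ones B + rankSumˡ ∣_∣ ds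
σ-++-reverse B ds = trans (rankSumʳ-++ ∣_∣ B (reverse ds))
  (cong₂ (λ m r → σ B + m * ones B + r) (length-reverse ds) (rankSumʳ-reverse ∣_∣ ds))

Counts-1+mono : ∀ {e m} (α β : Bit → ℕ) → α ○ ≡ 0 → β ○ ≡ 0 → α ● ≡ e → β ● ≡ m →
                Counts (one ⊕ mono e m) (Graded Bit α β)
Counts-1+mono α β α○ β○ α● β● = Counts-↔ (Graded-↔ ⊤⊎⊤↔Bit resp-α resp-β) (Counts-⊕ Counts-one (Counts-mono _ _))
  where
  ⊤⊎⊤↔Bit : (⊤ ⊎ ⊤) ↔ Bit
  ⊤⊎⊤↔Bit = mk↔ₛ′ [ const ○ , const ● ] (λ { ○ → inj₁ tt ; ● → inj₂ tt })
                  (λ { ○ → refl ; ● → refl }) (λ { (inj₁ _) → refl ; (inj₂ _) → refl })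
  resp-α : ∀ x → α (to ⊤⊎⊤↔Bit x) ≡ [ const 0 , const _ ] x
  resp-α (inj₁ _) = α○
  resp-α (inj₂ _) = α●
  resp-β : ∀ x → β (to ⊤⊎⊤↔Bit x) ≡ [ const 0 , const _ ] x
  resp-β (inj₁ _) = β○
  resp-β (inj₂ _) = β●

-- Strict overpartitions as gap sequences

Block : Set
Block = Bit × ℕ

gap : Block → ℕ
gap (b , z) = suc (∣ b ∣ + z)

overlinedBlocks : List Block → ℕ
overlinedBlocks = total (∣_∣ ∘ proj₁)

GapSequences : ℕ → ℕ → Set
GapSequences = Graded (List Block) overlinedBlocks (rankSumˡ gap)

bit : Bool → Bit
bit false = ○
bit true  = ●

toGaps : List (ℕ × Bool) → List Block
toGaps []            = []
toGaps ((p , o) ∷ l) = (bit o , p ∸ next l ∸ suc ∣ bit o ∣) ∷ toGaps l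

fromGaps : List Block → List (ℕ × Bool)
fromGaps []            = []
fromGaps ((b , z) ∷ l) = (gap (b , z) + total gap l , is-just b) ∷ fromGaps l

next-fromGaps : ∀ l → next (fromGaps l) ≡ total gap l
next-fromGaps []      = refl
next-fromGaps (_ ∷ _) = refl

gap-fits : ∀ p o nx → nx < p → overlineOK p o nx → suc ∣ bit o ∣ ≤ p ∸ nx
gap-fits p false nx nx<p _         = m<n⇒0<n∸m nx<p
gap-fits p true  nx _    (_ , 2≤p∸nx) = 2≤p∸nx

total-gap-toGaps : ∀ l → IsStrictOverpartition l → total gap (toGaps l) ≡ next l
total-gap-toGaps []            _                          = refl
total-gap-toGaps ((p , o) ∷ l) (_ , next<p , ok , valid) = begin
  suc ∣ bit o ∣ + (p ∸ next l ∸ suc ∣ bit o ∣) + total gap (toGaps l)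
    ≡⟨ cong₂ _+_ (m+[n∸m]≡n (gap-fits p o (next l) next<p ok)) (total-gap-toGaps l valid) ⟩
  p ∸ next l + next l
    ≡⟨ m∸n+n≡m (<⇒≤ next<p) ⟩
  p ∎
  where open ≡-Reasoning

rankSumˡ-gap-toGaps : ∀ l → IsStrictOverpartition l → rankSumˡ gap (toGaps l) ≡ size l
rankSumˡ-gap-toGaps []            _                  = refl
rankSumˡ-gap-toGaps ((p , o) ∷ l) valid@(_ , _ , _ , valid′) =
  cong₂ _+_ (total-gap-toGaps ((p , o) ∷ l) valid) (rankSumˡ-gap-toGaps l valid′)

overlinedBlocks-toGaps : ∀ l → overlinedBlocks (toGaps l) ≡ numOverlined l
overlinedBlocks-toGaps []                = refl
overlinedBlocks-toGaps ((_ , false) ∷ l) = overlinedBlocks-toGaps l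
overlinedBlocks-toGaps ((_ , true)  ∷ l) = cong suc (overlinedBlocks-toGaps l)

fromGaps-valid : ∀ l → IsStrictOverpartition (fromGaps l)
fromGaps-valid []            = tt
fromGaps-valid ((b , z) ∷ l) rewrite next-fromGaps l =
  s≤s z≤n , s≤s (m≤n+m (total gap l) (∣ b ∣ + z)) , overline-ok b , fromGaps-valid l
  where
  overline-ok : ∀ b → overlineOK (gap (b , z) + total gap l) (is-just b) (total gap l)
  overline-ok ○ = tt
  overline-ok ● = s≤s (s≤s z≤n) , ≤-trans (s≤s (s≤s z≤n)) (≤-reflexive (sym (m+n∸n≡m (2 + z) (total gap l))))

size-fromGaps : ∀ l → size (fromGaps l) ≡ rankSumˡ gap l
size-fromGaps []      = refl
size-fromGaps (x ∷ l) = cong (gap x + total gap l +_) (size-fromGaps l)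

numOverlined-fromGaps : ∀ l → numOverlined (fromGaps l) ≡ overlinedBlocks l
numOverlined-fromGaps []            = refl
numOverlined-fromGaps ((○ , _) ∷ l) = numOverlined-fromGaps l
numOverlined-fromGaps ((● , _) ∷ l) = cong suc (numOverlined-fromGaps l)

toGaps-fromGaps : ∀ l → toGaps (fromGaps l) ≡ l
toGaps-fromGaps []            = refl
toGaps-fromGaps ((b , z) ∷ l) rewrite next-fromGaps l = cong₂ _∷_ (block-back b) (toGaps-fromGaps l)
  where
  block-back : ∀ b → (bit (is-just b) , gap (b , z) + total gap l ∸ total gap l ∸ suc ∣ bit (is-just b) ∣) ≡ (b , z)
  block-back ○ = cong (○ ,_) (cong (_∸ 1) (m+n∸n≡m (suc z) (total gap l)))
  block-back ● = cong (● ,_) (cong (_∸ 2) (m+n∸n≡m (2 + z) (total gap l)))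

fromGaps-toGaps : ∀ l → IsStrictOverpartition l → fromGaps (toGaps l) ≡ l
fromGaps-toGaps []            _                          = refl
fromGaps-toGaps ((p , o) ∷ l) valid@(_ , _ , _ , valid′) =
  cong₂ _∷_ (cong₂ _,_ (total-gap-toGaps ((p , o) ∷ l) valid) (is-just-bit o)) (fromGaps-toGaps l valid′)
  where
  is-just-bit : ∀ o → is-just (bit o) ≡ o
  is-just-bit false = refl
  is-just-bit true  = refl

IsStrictOverpartition-irrelevant : ∀ l → Irrelevant (IsStrictOverpartition l)
IsStrictOverpartition-irrelevant []            _ _ = refl
IsStrictOverpartition-irrelevant ((p , o) ∷ l) (a , b , c , d) (a′ , b′ , c′ , d′) =
  cong₂ _,_ (≤-irrelevant a a′) (cong₂ _,_ (≤-irrelevant b b′) (cong₂ _,_ (overlineOK-irrelevant o c c′)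
                                                                          (IsStrictOverpartition-irrelevant l d d′)))
  where
  overlineOK-irrelevant : ∀ o → Irrelevant (overlineOK p o (next l))
  overlineOK-irrelevant false _ _ = refl
  overlineOK-irrelevant true  = ×-irrelevant ≤-irrelevant ≤-irrelevant

SOP↔GapSequences : ∀ {k N} → SOP k N ↔ GapSequences k N
SOP↔GapSequences = subset-↔
  (×-irrelevant (IsStrictOverpartition-irrelevant _) ≡×≡-irrelevant) ≡×≡-irrelevant
  toGaps fromGaps
  (λ {l} (valid , size≡N , #≡k) → trans (overlinedBlocks-toGaps l) #≡k , trans (rankSumˡ-gap-toGaps l valid) size≡N)
  (λ {l} (#≡k , weight≡N) → fromGaps-valid l , trans (size-fromGaps l) weight≡N , trans (numOverlined-fromGaps l) #≡k)
  (λ {l} _ → toGaps-fromGaps l)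
  (λ {l} (valid , _) → fromGaps-toGaps l valid)

-- The middle sum

overlinedBlocks-zip : ∀ (bs : List Bit) (zs : List ℕ) → length bs ≡ length zs →
                      overlinedBlocks (zip bs zs) ≡ total ∣_∣ bs
overlinedBlocks-zip []       []       _         = refl
overlinedBlocks-zip (b ∷ bs) (z ∷ zs) |bs|≡|zs| =
  cong (∣ b ∣ +_) (overlinedBlocks-zip bs zs (suc-injective |bs|≡|zs|))

rankSumʳ-gap-zip : ∀ (bs : List Bit) (zs : List ℕ) → length bs ≡ length zs →
                   rankSumʳ gap (zip bs zs) ≡ rankSumʳ ∣_∣ bs + rankSumʳ id zs + rankSumʳ (const 1) bs
rankSumʳ-gap-zip []       []       _         = refl
rankSumʳ-gap-zip (b ∷ bs) (z ∷ zs) |bs|≡|zs| = begin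
  suc (length (zip bs zs)) * suc (∣ b ∣ + z) + rankSumʳ gap (zip bs zs)
    ≡⟨ cong₂ (λ m r → suc m * suc (∣ b ∣ + z) + r) (length-zip bs zs |bs|≡|zs|′) (rankSumʳ-gap-zip bs zs |bs|≡|zs|′) ⟩
  suc m * suc (∣ b ∣ + z) + (rankSumʳ ∣_∣ bs + rankSumʳ id zs + rankSumʳ (const 1) bs)
    ≡⟨ rearrange m ∣ b ∣ z (rankSumʳ ∣_∣ bs) (rankSumʳ id zs) (rankSumʳ (const 1) bs) ⟩
  (suc m * ∣ b ∣ + rankSumʳ ∣_∣ bs) + (suc m * z + rankSumʳ id zs) + (suc m * 1 + rankSumʳ (const 1) bs)
    ≡⟨ cong (λ m′ → (suc m * ∣ b ∣ + rankSumʳ ∣_∣ bs) + (suc m′ * z + rankSumʳ id zs)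
                    + (suc m * 1 + rankSumʳ (const 1) bs)) |bs|≡|zs|′ ⟩
  rankSumʳ ∣_∣ (b ∷ bs) + rankSumʳ id (z ∷ zs) + rankSumʳ (const 1) (b ∷ bs) ∎
  where
  open ≡-Reasoning
  m : ℕ
  m = length bs
  |bs|≡|zs|′ : length bs ≡ length zs
  |bs|≡|zs|′ = suc-injective |bs|≡|zs|
  rearrange : ∀ m x z r s t → suc m * suc (x + z) + (r + s + t) ≡ (suc m * x + r) + (suc m * z + s) + (suc m * 1 + t)
  rearrange = solve-∀

GapSequencesOfLength : ℕ → ℕ → ℕ → Set
GapSequencesOfLength n = Graded (ListOfLength Block n) (overlinedBlocks ∘ proj₁) (rankSumˡ gap ∘ proj₁)

Counts-middleTerm : ∀ n → Counts (middleTerm n) (GapSequencesOfLength n)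
Counts-middleTerm n =
  Counts-↔ (Graded-↔ (↔-trans drop-⊤ (↔-trans zip-↔ reverse-↔)) resp-α resp-β)
           (Counts-⊗ (Counts-⊗ counts-negAQPoch counts-invQPoch) (Counts-mono 0 ((n * suc n) / 2)))
  where
  drop-⊤ : (A × ⊤) ↔ A
  drop-⊤ = mk↔ₛ′ proj₁ (_, tt) (λ _ → refl) (λ _ → refl)
  counts-negAQPoch : Counts (negAQPoch n) (Graded (ListOfLength Bit n) (total ∣_∣ ∘ proj₁) (rankSumʳ ∣_∣ ∘ proj₁))
  counts-negAQPoch = Counts-prodBelow ∣_∣ ∣_∣
    (λ i → Counts-1+mono ∣_∣ (λ b → suc i * ∣ b ∣) refl (*-zeroʳ (suc i)) refl (*-identityʳ (suc i))) n
  counts-invQPoch : Counts (invQPoch n) (Graded (ListOfLength ℕ n) (total (const 0) ∘ proj₁) (rankSumʳ id ∘ proj₁))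
  counts-invQPoch = Counts-prodBelow (const 0) id Counts-invOneMinusQ^suc n
  resp-α : ∀ ((((bs , |bs|≡n) , (zs , |zs|≡n)) , _) : (ListOfLength Bit n × ListOfLength ℕ n) × ⊤) →
           overlinedBlocks (reverse (zip bs zs)) ≡ total ∣_∣ bs + total (const 0) zs + 0
  resp-α (((bs , |bs|≡n) , (zs , |zs|≡n)) , _) = begin
    overlinedBlocks (reverse (zip bs zs)) ≡⟨ total-reverse _ (zip bs zs) ⟩
    overlinedBlocks (zip bs zs)           ≡⟨ overlinedBlocks-zip bs zs (trans |bs|≡n (sym |zs|≡n)) ⟩
    total ∣_∣ bs                          ≡⟨ sym (+-identityʳ _) ⟩
    total ∣_∣ bs + 0                      ≡⟨ cong (total ∣_∣ bs +_) (trans (+-identityʳ _) (total-zero zs)) ⟨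
    total ∣_∣ bs + (total (const 0) zs + 0) ≡⟨ sym (+-assoc (total ∣_∣ bs) _ 0) ⟩
    total ∣_∣ bs + total (const 0) zs + 0 ∎
    where open ≡-Reasoning
  resp-β : ∀ ((((bs , |bs|≡n) , (zs , |zs|≡n)) , _) : (ListOfLength Bit n × ListOfLength ℕ n) × ⊤) →
           rankSumˡ gap (reverse (zip bs zs)) ≡ rankSumʳ ∣_∣ bs + rankSumʳ id zs + (n * suc n) / 2
  resp-β (((bs , refl) , (zs , |zs|≡n)) , _) = begin
    rankSumˡ gap (reverse (zip bs zs))
      ≡⟨ rankSumˡ-reverse gap (zip bs zs) ⟩
    rankSumʳ gap (zip bs zs)
      ≡⟨ rankSumʳ-gap-zip bs zs (sym |zs|≡n) ⟩
    rankSumʳ ∣_∣ bs + rankSumʳ id zs + rankSumʳ (const 1) bs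
      ≡⟨ cong (rankSumʳ ∣_∣ bs + rankSumʳ id zs +_) (sym (triangle bs)) ⟩
    rankSumʳ ∣_∣ bs + rankSumʳ id zs + (length bs * suc (length bs)) / 2 ∎
    where open ≡-Reasoning

length≤total-gap : ∀ l → length l ≤ total gap l
length≤total-gap []      = z≤n
length≤total-gap (x ∷ l) = s≤s (≤-trans (length≤total-gap l) (m≤n+m _ _))

Counts-middleSeries : Counts middleSeries GapSequences
Counts-middleSeries k N = Card-↔ by-length (Card-Below (suc N) (λ n → Counts-middleTerm n k N))
  where
  length≤N : ∀ l → rankSumˡ gap l ≡ N → length l ≤ N
  length≤N l weight≡N = ≤-trans (length≤total-gap l) (≤-trans (total≤rankSumˡ gap l) (≤-reflexive weight≡N))
  by-length : Below (suc N) (λ n → GapSequencesOfLength n k N) ↔ GapSequences k N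
  by-length = mk↔ₛ′ (λ (_ , _ , (l , _) , w) → l , w)
    (λ (l , w) → length l , s≤s (length≤N l (proj₂ w)) , (l , refl) , w)
    (λ _ → refl)
    (λ { (_ , _ , (l , refl) , w) → cong (λ n<1+N → length l , n<1+N , (l , refl) , w) (<-irrelevant _ _) })

-- Gap sequences as tile words

module _ {X : Set} where

  runsWord : List (X × ℕ) → List (Maybe X)
  runsWord []            = []
  runsWord ((x , z) ∷ l) = just x ∷ replicate z nothing ++ runsWord l

  fromRuns : ℕ × List (X × ℕ) → List (Maybe X)
  fromRuns (t , l) = replicate t nothing ++ runsWord l

  toRuns : List (Maybe X) → ℕ × List (X × ℕ)
  toRuns []            = 0 , []
  toRuns (nothing ∷ w) = suc (proj₁ (toRuns w)) , proj₂ (toRuns w)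
  toRuns (just x ∷ w)  = 0 , (x , proj₁ (toRuns w)) ∷ proj₂ (toRuns w)

  toRuns-fromRuns : ∀ t l → toRuns (fromRuns (t , l)) ≡ (t , l)
  toRuns-fromRuns (suc t) l             = cong (λ (t , l) → suc t , l) (toRuns-fromRuns t l)
  toRuns-fromRuns zero    []            = refl
  toRuns-fromRuns zero    ((x , z) ∷ l) = cong (λ (z , l) → 0 , (x , z) ∷ l) (toRuns-fromRuns z l)

  fromRuns-toRuns : ∀ w → fromRuns (toRuns w) ≡ w
  fromRuns-toRuns []            = refl
  fromRuns-toRuns (nothing ∷ w) = cong (nothing ∷_) (fromRuns-toRuns w)
  fromRuns-toRuns (just x ∷ w)  = cong (just x ∷_) (fromRuns-toRuns w)

  fromRuns-toRuns-padded : ∀ w {m n} → proj₁ (toRuns w) + m ≡ n → fromRuns (n ∸ m , proj₂ (toRuns w)) ≡ w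
  fromRuns-toRuns-padded w {m} t+m≡n =
    trans (cong (λ t → fromRuns (t , proj₂ (toRuns w))) (trans (cong (_∸ m) (sym t+m≡n)) (m+n∸n≡m _ m)))
          (fromRuns-toRuns w)

length-fromRuns : ∀ {X : Set} t (zs : List (X × ℕ)) → length (fromRuns (t , zs)) ≡ t + length (runsWord zs)
length-fromRuns t zs = trans (length-++ (replicate t nothing)) (cong (_+ length (runsWord zs)) (length-replicate t))

-- A column of cells read from the top: nothing is an empty cell, just b a part covering width b cells.
Tile : Set
Tile = Maybe Bit

width : Bit → ℕ
width b = suc ∣ b ∣

cells : Tile → ℕ
cells nothing  = 1
cells (just b) = width b

overlinedTiles : List Tile → ℕ
overlinedTiles = total (maybe ∣_∣ 0)

partSum : List Tile → ℕ
partSum []            = 0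
partSum (nothing ∷ w) = partSum w
partSum (just b ∷ w)  = width b + total cells w + partSum w

TileWords : ℕ → ℕ → Set
TileWords k N = Σ (List Tile) λ w → total cells w ≡ N × overlinedTiles w ≡ k × partSum w ≡ N

partSum-blanks-++ : ∀ t w → partSum (replicate t nothing ++ w) ≡ partSum w
partSum-blanks-++ zero    w = refl
partSum-blanks-++ (suc t) w = partSum-blanks-++ t w

cells-runsWord : ∀ l → total cells (runsWord l) ≡ total gap l
cells-fromRuns : ∀ t l → total cells (fromRuns (t , l)) ≡ t + total gap l

cells-runsWord []            = refl
cells-runsWord ((b , z) ∷ l) = trans (cong (width b +_) (cells-fromRuns z l)) (sym (+-assoc (width b) z _))

cells-fromRuns t l =
  trans (total-blanks-++ cells t nothing (runsWord l)) (cong₂ _+_ (*-identityʳ t) (cells-runsWord l))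

overlinedTiles-runsWord : ∀ l → overlinedTiles (runsWord l) ≡ overlinedBlocks l
overlinedTiles-fromRuns : ∀ t l → overlinedTiles (fromRuns (t , l)) ≡ overlinedBlocks l

overlinedTiles-runsWord []            = refl
overlinedTiles-runsWord ((b , z) ∷ l) = cong (∣ b ∣ +_) (overlinedTiles-fromRuns z l)

overlinedTiles-fromRuns t l =
  trans (total-blanks-++ (maybe ∣_∣ 0) t nothing (runsWord l)) (cong₂ _+_ (*-zeroʳ t) (overlinedTiles-runsWord l))

partSum-runsWord : ∀ l → partSum (runsWord l) ≡ rankSumˡ gap l
partSum-fromRuns : ∀ t l → partSum (fromRuns (t , l)) ≡ rankSumˡ gap l

partSum-runsWord []            = refl
partSum-runsWord ((b , z) ∷ l) = cong₂ _+_ (cells-runsWord ((b , z) ∷ l)) (partSum-fromRuns z l)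

partSum-fromRuns t l = trans (partSum-blanks-++ t (runsWord l)) (partSum-runsWord l)

GapSequences↔TileWords : ∀ {k N} → GapSequences k N ↔ TileWords k N
GapSequences↔TileWords {k} {N} = subset-↔ ≡×≡-irrelevant (×-irrelevant ≡-irrelevant ≡×≡-irrelevant)
  (λ l → fromRuns (pad l , l)) (proj₂ ∘ toRuns)
  (λ {l} (#≡k , weight≡N) →
     trans (cells-fromRuns (pad l) l) (m∸n+n≡m (≤-trans (total≤rankSumˡ gap l) (≤-reflexive weight≡N))) ,
     trans (overlinedTiles-fromRuns (pad l) l) #≡k ,
     trans (partSum-fromRuns (pad l) l) weight≡N)
  (λ {w} (_ , #≡k , partSum≡N) → let (t , l) = toRuns w in
     trans (sym (overlinedTiles-fromRuns t l)) (trans (cong overlinedTiles (fromRuns-toRuns w)) #≡k) ,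
     trans (sym (partSum-fromRuns t l)) (trans (cong partSum (fromRuns-toRuns w)) partSum≡N))
  (λ {w} (cells≡N , _) → let (t , l) = toRuns w in fromRuns-toRuns-padded w
     (trans (sym (cells-fromRuns t l)) (trans (cong (total cells) (fromRuns-toRuns w)) cells≡N)))
  (λ {l} _ → cong proj₂ (toRuns-fromRuns (pad l) l))
  where
  pad : List Block → ℕ
  pad l = N ∸ total gap l

-- Separating the overlined parts from the plain ones

overlinedSum : List Bit → ℕ
overlinedSum []      = 0
overlinedSum (○ ∷ A) = overlinedSum A
overlinedSum (● ∷ A) = 2 + total width A + overlinedSum A

split : List Tile → List Bit × List Bit
split []            = [] , []
split (nothing ∷ w) = let (A , B) = split w in ○ ∷ A , ○ ∷ B
split (just ○ ∷ w)  = let (A , B) = split w in A , ● ∷ B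
split (just ● ∷ w)  = let (A , B) = split w in ● ∷ A , ○ ∷ B

merge : List Bit → List Bit → List Tile
merge A       []      = []
merge A       (● ∷ B) = just ○ ∷ merge A B
merge []      (○ ∷ B) = nothing ∷ merge [] B
merge (○ ∷ A) (○ ∷ B) = nothing ∷ merge A B
merge (● ∷ A) (○ ∷ B) = just ● ∷ merge A B

merge-split : ∀ w → let (A , B) = split w in merge A B ≡ w
merge-split []            = refl
merge-split (nothing ∷ w) = cong (nothing ∷_) (merge-split w)
merge-split (just ○ ∷ w)  = cong (just ○ ∷_) (merge-split w)
merge-split (just ● ∷ w)  = cong (just ● ∷_) (merge-split w)

split-merge : ∀ A B → length A ≡ zeros B → split (merge A B) ≡ (A , B)
split-merge []      []      _       = refl
split-merge A       (● ∷ B) |A|≡#○B = cong (λ (A , B) → A , ● ∷ B) (split-merge A B |A|≡#○B)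
split-merge (○ ∷ A) (○ ∷ B) |A|≡#○B = cong (λ (A , B) → ○ ∷ A , ○ ∷ B) (split-merge A B (suc-injective |A|≡#○B))
split-merge (● ∷ A) (○ ∷ B) |A|≡#○B = cong (λ (A , B) → ● ∷ A , ○ ∷ B) (split-merge A B (suc-injective |A|≡#○B))

length-split : ∀ w → let (A , B) = split w in length A ≡ zeros B
length-split []            = refl
length-split (nothing ∷ w) = cong suc (length-split w)
length-split (just ○ ∷ w)  = length-split w
length-split (just ● ∷ w)  = cong suc (length-split w)

overlinedTiles-split : ∀ w → let (A , B) = split w in overlinedTiles w ≡ ones A
overlinedTiles-split []            = refl
overlinedTiles-split (nothing ∷ w) = overlinedTiles-split w
overlinedTiles-split (just ○ ∷ w)  = overlinedTiles-split w
overlinedTiles-split (just ● ∷ w)  = cong suc (overlinedTiles-split w)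

cells-split : ∀ w → let (A , B) = split w in total cells w ≡ length B + ones A
cells-split []            = refl
cells-split (nothing ∷ w) = cong suc (cells-split w)
cells-split (just ○ ∷ w)  = cong suc (cells-split w)
cells-split (just ● ∷ w)  = cong suc (trans (cong suc (cells-split w)) (sym (+-suc _ _)))

cells-split-width : ∀ w → let (A , B) = split w in total cells w ≡ total width A + ones B
cells-split-width []            = refl
cells-split-width (nothing ∷ w) = cong suc (cells-split-width w)
cells-split-width (just ○ ∷ w)  = trans (cong suc (cells-split-width w)) (sym (+-suc _ _))
cells-split-width (just ● ∷ w)  = cong (2 +_) (cells-split-width w)

partSum-split : ∀ w → let (A , B) = split w in partSum w ≡ overlinedSum A + σ B + ones A * ones B
partSum-split []            = refl
partSum-split (nothing ∷ w) = let (A , B) = split w in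
  trans (partSum-split w) (sym (cong (λ m → overlinedSum A + (m + σ B) + ones A * ones B) (*-zeroʳ (suc (length B)))))
partSum-split (just ○ ∷ w)  = let (A , B) = split w in
  trans (cong₂ (λ c p → 1 + c + p) (cells-split w) (partSum-split w))
        (rearrange (length B) (ones A) (overlinedSum A) (σ B) (ones B))
  where
  rearrange : ∀ m a x s b → 1 + (m + a) + (x + s + a * b) ≡ x + (suc m * 1 + s) + a * (1 + b)
  rearrange = solve-∀
partSum-split (just ● ∷ w)  = let (A , B) = split w in
  trans (cong₂ (λ c p → 2 + c + p) (cells-split-width w) (partSum-split w))
        (rearrange (length B) (total width A) (ones B) (overlinedSum A) (σ B) (ones A))
  where
  rearrange : ∀ m t b x s a → 2 + (t + b) + (x + s + a * b) ≡ 2 + t + x + (suc m * 0 + s) + suc a * b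
  rearrange = solve-∀

SplitPairs : ℕ → ℕ → Set
SplitPairs k N = Σ (List Bit × List Bit) λ (A , B) →
  length A ≡ zeros B × length B + k ≡ N × ones A ≡ k × overlinedSum A + σ B + k * ones B ≡ N

TileWords↔SplitPairs : ∀ {k N} → TileWords k N ↔ SplitPairs k N
TileWords↔SplitPairs {k} {N} = subset-↔ (×-irrelevant ≡-irrelevant ≡×≡-irrelevant)
  (×-irrelevant ≡-irrelevant (×-irrelevant ≡-irrelevant ≡×≡-irrelevant))
  split (λ (A , B) → merge A B)
  (λ {w} (cells≡N , #≡k , partSum≡N) → let (A , B) = split w ; ones≡k = trans (sym (overlinedTiles-split w)) #≡k in
     length-split w ,
     trans (cong (length B +_) (sym ones≡k)) (trans (sym (cells-split w)) cells≡N) ,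
     ones≡k ,
     trans (cong (λ a → overlinedSum A + σ B + a * ones B) (sym ones≡k)) (trans (sym (partSum-split w)) partSum≡N))
  (λ {(A , B)} (|A|≡#○B , |B|+k≡N , ones≡k , sum≡N) → let w = merge A B ; split≡ = split-merge A B |A|≡#○B in
     trans (cells-split w)
           (trans (cong (λ (A , B) → length B + ones A) split≡) (trans (cong (length B +_) ones≡k) |B|+k≡N)) ,
     trans (overlinedTiles-split w) (trans (cong (ones ∘ proj₁) split≡) ones≡k) ,
     trans (partSum-split w) (trans (cong (λ (A , B) → overlinedSum A + σ B + ones A * ones B) split≡)
                                    (trans (cong (λ a → overlinedSum A + σ B + a * ones B) ones≡k) sum≡N)))
  (λ {(A , B)} (|A|≡#○B , _) → split-merge A B |A|≡#○B)
  (λ {w} _ → merge-split w)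

IsRunPair : ℕ → ℕ → List (⊤ × ℕ) × List Bit → Set
IsRunPair k N (zs , B) = length zs ≡ k × length B + k ≡ N × overlinedSum (runsWord zs) + σ B + k * ones B ≡ N

RunPairs : ℕ → ℕ → Set
RunPairs k N = Σ (List (⊤ × ℕ) × List Bit) (IsRunPair k N)

ones-runsWord : ∀ (zs : List (⊤ × ℕ)) → ones (runsWord zs) ≡ length zs
ones-fromRuns : ∀ t zs → ones (fromRuns (t , zs)) ≡ length zs

ones-runsWord []             = refl
ones-runsWord ((_ , z) ∷ zs) = cong suc (ones-fromRuns z zs)

ones-fromRuns t zs = trans (bits-blanks-++ ones (λ _ → refl) t (runsWord zs)) (ones-runsWord zs)

width-runsWord≤overlinedSum : ∀ (zs : List (⊤ × ℕ)) → total width (runsWord zs) ≤ overlinedSum (runsWord zs)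
width-runsWord≤overlinedSum []      = z≤n
width-runsWord≤overlinedSum (_ ∷ _) = m≤m+n _ _

runsWord-fits : ∀ {k N} zs B → length zs ≡ k → length B + k ≡ N →
                overlinedSum (runsWord zs) + σ B + k * ones B ≡ N → length (runsWord zs) ≤ zeros B
runsWord-fits {k} {N} zs B |zs|≡k |B|+k≡N sum≡N = +-cancelʳ-≤ (k + ones B) _ _ (begin
  length R + (k + ones B)              ≡⟨ +-assoc _ k (ones B) ⟨
  length R + k + ones B                ≡⟨ cong (λ m → length R + m + ones B) (trans (ones-runsWord zs) |zs|≡k) ⟨
  length R + ones R + ones B           ≡⟨ cong (_+ ones B) (total-suc ∣_∣ R) ⟨
  total width R + ones B               ≤⟨ +-mono-≤ (width-runsWord≤overlinedSum zs) (total≤rankSumʳ ∣_∣ B) ⟩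
  overlinedSum R + σ B                 ≤⟨ m≤m+n _ (k * ones B) ⟩
  overlinedSum R + σ B + k * ones B    ≡⟨ trans sum≡N (sym |B|+k≡N) ⟩
  length B + k                         ≡⟨ cong (_+ k) (length≡zeros+ones B) ⟩
  zeros B + ones B + k                 ≡⟨ rearrange (zeros B) (ones B) k ⟩
  zeros B + (k + ones B)               ∎)
  where
  open ≤-Reasoning
  R : List Bit
  R = runsWord zs
  rearrange : ∀ z o k → z + o + k ≡ z + (k + o)
  rearrange = solve-∀

overlinedSum-fromRuns : ∀ t (zs : List (⊤ × ℕ)) → overlinedSum (fromRuns (t , zs)) ≡ overlinedSum (runsWord zs)
overlinedSum-fromRuns t zs = bits-blanks-++ overlinedSum (λ _ → refl) t (runsWord zs)

SplitPairs↔RunPairs : ∀ {k N} → SplitPairs k N ↔ RunPairs k N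
SplitPairs↔RunPairs {k} {N} = subset-↔ (×-irrelevant ≡-irrelevant (×-irrelevant ≡-irrelevant ≡×≡-irrelevant))
  (×-irrelevant ≡-irrelevant ≡×≡-irrelevant)
  (λ (A , B) → proj₂ (toRuns A) , B) (λ (zs , B) → fromRuns (pad zs B , zs) , B)
  (λ {(A , B)} (_ , |B|+k≡N , ones≡k , sum≡N) → let (t , zs) = toRuns A in
     trans (sym (ones-fromRuns t zs)) (trans (cong ones (fromRuns-toRuns A)) ones≡k) ,
     |B|+k≡N ,
     trans (cong (λ s → s + σ B + k * ones B)
                 (trans (sym (overlinedSum-fromRuns t zs)) (cong overlinedSum (fromRuns-toRuns A)))) sum≡N)
  (λ {(zs , B)} (|zs|≡k , |B|+k≡N , sum≡N) →
     trans (length-fromRuns (pad zs B) zs) (m∸n+n≡m (runsWord-fits zs B |zs|≡k |B|+k≡N sum≡N)) ,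
     |B|+k≡N ,
     trans (ones-fromRuns (pad zs B) zs) |zs|≡k ,
     trans (cong (λ s → s + σ B + k * ones B) (overlinedSum-fromRuns (pad zs B) zs)) sum≡N)
  (λ {(zs , B)} _ → cong (_, B) (cong proj₂ (toRuns-fromRuns (pad zs B) zs)))
  (λ {(A , B)} (|A|≡#○B , _) → let (t , zs) = toRuns A in
     cong (_, B) (fromRuns-toRuns-padded A
       (trans (sym (length-fromRuns t zs)) (trans (cong length (fromRuns-toRuns A)) |A|≡#○B))))
  where
  pad : List (⊤ × ℕ) → List Bit → ℕ
  pad zs B = zeros B ∸ length (runsWord zs)

-- Halving the gaps of the overlined parts

half : ℕ → ℕ × Bit
half zero          = 0 , ○
half (suc zero)    = 0 , ●
half (suc (suc n)) = let (e , d) = half n in suc e , d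

unhalf : ℕ × Bit → ℕ
unhalf (e , d) = ∣ d ∣ + (e + e)

unhalf-suc : ∀ e d → unhalf (suc e , d) ≡ 2 + unhalf (e , d)
unhalf-suc e d = rearrange ∣ d ∣ e
  where
  rearrange : ∀ d e → d + (suc e + suc e) ≡ 2 + (d + (e + e))
  rearrange = solve-∀

unhalf-half : ∀ n → unhalf (half n) ≡ n
unhalf-half zero          = refl
unhalf-half (suc zero)    = refl
unhalf-half (suc (suc n)) = let (e , d) = half n in trans (unhalf-suc e d) (cong (2 +_) (unhalf-half n))

half-unhalf : ∀ p → half (unhalf p) ≡ p
half-unhalf (zero  , ○) = refl
half-unhalf (zero  , ●) = refl
half-unhalf (suc e , d) = trans (cong half (unhalf-suc e d)) (cong (λ (e , d) → suc e , d) (half-unhalf (e , d)))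

module _ {X : Set} where

  halve : List (X × ℕ) → List (X × ℕ) × List Bit
  halve []            = [] , []
  halve ((x , z) ∷ l) = let (e , d) = half z ; (es , ds) = halve l in (x , e) ∷ es , d ∷ ds

  unhalve : List (X × ℕ) → List Bit → List (X × ℕ)
  unhalve ((x , e) ∷ es) (d ∷ ds) = (x , unhalf (e , d)) ∷ unhalve es ds
  unhalve _              _        = []

  unhalve-halve : ∀ l → let (es , ds) = halve l in unhalve es ds ≡ l
  unhalve-halve []            = refl
  unhalve-halve ((x , z) ∷ l) = cong₂ (λ z l → (x , z) ∷ l) (unhalf-half z) (unhalve-halve l)

  halve-unhalve : ∀ es ds → length es ≡ length ds → halve (unhalve es ds) ≡ (es , ds)
  halve-unhalve []             []       _ = refl
  halve-unhalve ((x , e) ∷ es) (d ∷ ds) |es|≡|ds| =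
    cong₂ (λ (e , d) (es , ds) → (x , e) ∷ es , d ∷ ds)
          (half-unhalf (e , d)) (halve-unhalve es ds (suc-injective |es|≡|ds|))

  length-halve : ∀ l → let (es , ds) = halve l in length es ≡ length l × length ds ≡ length l
  length-halve []      = refl , refl
  length-halve (_ ∷ l) = let (|es|≡ , |ds|≡) = length-halve l in cong suc |es|≡ , cong suc |ds|≡

  length-unhalve : ∀ es ds → length es ≡ length ds → length (unhalve es ds) ≡ length es
  length-unhalve []       []       _         = refl
  length-unhalve (_ ∷ es) (_ ∷ ds) |es|≡|ds| = cong suc (length-unhalve es ds (suc-injective |es|≡|ds|))

width-fromRuns : ∀ t (zs : List (⊤ × ℕ)) → total width (fromRuns (t , zs)) ≡ t + total width (runsWord zs)
width-fromRuns t zs =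
  trans (total-blanks-++ width t ○ (runsWord zs)) (cong (_+ total width (runsWord zs)) (*-identityʳ t))

σ-fromRuns : ∀ t (zs : List (⊤ × ℕ)) → σ (fromRuns (t , zs)) ≡ σ (runsWord zs)
σ-fromRuns t zs = bits-blanks-++ σ (λ l → cong (_+ σ l) (*-zeroʳ (suc (length l)))) t (runsWord zs)

width-runsWord-unhalve : ∀ (es : List (⊤ × ℕ)) ds → length es ≡ length ds →
                         total width (runsWord (unhalve es ds)) ≡ 2 * length (runsWord es) + ones ds
width-runsWord-unhalve []             []       _         = refl
width-runsWord-unhalve ((_ , e) ∷ es) (d ∷ ds) |es|≡|ds| = begin
  2 + total width (fromRuns (unhalf (e , d) , unhalve es ds))
    ≡⟨ cong (2 +_) (width-fromRuns _ (unhalve es ds)) ⟩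
  2 + (∣ d ∣ + (e + e) + total width (runsWord (unhalve es ds)))
    ≡⟨ cong (λ w → 2 + (∣ d ∣ + (e + e) + w)) (width-runsWord-unhalve es ds (suc-injective |es|≡|ds|)) ⟩
  2 + (∣ d ∣ + (e + e) + (2 * length (runsWord es) + ones ds))
    ≡⟨ rearrange ∣ d ∣ e (length (runsWord es)) (ones ds) ⟩
  2 * suc (e + length (runsWord es)) + (∣ d ∣ + ones ds)
    ≡⟨ cong (λ m → 2 * suc m + (∣ d ∣ + ones ds)) (sym (length-fromRuns e es)) ⟩
  2 * length (runsWord ((tt , e) ∷ es)) + ones (d ∷ ds) ∎
  where
  open ≡-Reasoning
  rearrange : ∀ d e m o → 2 + (d + (e + e) + (2 * m + o)) ≡ 2 * suc (e + m) + (d + o)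
  rearrange = solve-∀

overlinedSum-runsWord-unhalve : ∀ (es : List (⊤ × ℕ)) ds → length es ≡ length ds →
                                overlinedSum (runsWord (unhalve es ds)) ≡ 2 * σ (runsWord es) + rankSumˡ ∣_∣ ds
overlinedSum-runsWord-unhalve []             []       _         = refl
overlinedSum-runsWord-unhalve ((_ , e) ∷ es) (d ∷ ds) |es|≡|ds| = begin
  total width (runsWord (unhalve ((tt , e) ∷ es) (d ∷ ds))) + overlinedSum (fromRuns (unhalf (e , d) , unhalve es ds))
    ≡⟨ cong₂ _+_ (width-runsWord-unhalve ((tt , e) ∷ es) (d ∷ ds) |es|≡|ds|)
                 (trans (overlinedSum-fromRuns (unhalf (e , d)) (unhalve es ds))
                        (overlinedSum-runsWord-unhalve es ds (suc-injective |es|≡|ds|))) ⟩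
  2 * suc m + (∣ d ∣ + ones ds) + (2 * σ (runsWord es) + rankSumˡ ∣_∣ ds)
    ≡⟨ rearrange m ∣ d ∣ (ones ds) (σ (runsWord es)) (rankSumˡ ∣_∣ ds) ⟩
  2 * (suc m * 1 + σ (runsWord es)) + (∣ d ∣ + ones ds + rankSumˡ ∣_∣ ds)
    ≡⟨ cong (λ s → 2 * (suc m * 1 + s) + (∣ d ∣ + ones ds + rankSumˡ ∣_∣ ds)) (sym (σ-fromRuns e es)) ⟩
  2 * σ (runsWord ((tt , e) ∷ es)) + rankSumˡ ∣_∣ (d ∷ ds) ∎
  where
  open ≡-Reasoning
  m : ℕ
  m = length (fromRuns (e , es))
  rearrange : ∀ m d o s r → 2 * suc m + (d + o) + (2 * s + r) ≡ 2 * (suc m * 1 + s) + (d + o + r)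
  rearrange = solve-∀

overlinedSum-runsWord-halve : ∀ (zs : List (⊤ × ℕ)) → let (es , ds) = halve zs in
                              overlinedSum (runsWord zs) ≡ 2 * σ (runsWord es) + rankSumˡ ∣_∣ ds
overlinedSum-runsWord-halve zs = let (es , ds) = halve zs ; (|es|≡|zs| , |ds|≡|zs|) = length-halve zs in
  trans (cong (overlinedSum ∘ runsWord) (sym (unhalve-halve zs)))
        (overlinedSum-runsWord-unhalve es ds (trans |es|≡|zs| (sym |ds|≡|zs|)))

-- The product side

IsBitPair : ℕ → ℕ → List Bit × List Bit → Set
IsBitPair k N (x , y) = length x ≡ N × length y ≡ N × ones x ≡ k × 2 * σ x + σ y ≡ N

BitPairs : ℕ → ℕ → Set
BitPairs k N = Σ (List Bit × List Bit) (IsBitPair k N)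

length-runsWord≤σ : ∀ (zs : List (⊤ × ℕ)) → length (runsWord zs) ≤ σ (runsWord zs)
length-runsWord≤σ []      = z≤n
length-runsWord≤σ (_ ∷ _) = ≤-trans (≤-reflexive (sym (*-identityʳ _))) (m≤m+n _ _)

encodeRunPair : ℕ → List (⊤ × ℕ) × List Bit → List Bit × List Bit
encodeRunPair N (zs , B) = let (es , ds) = halve zs in fromRuns (N ∸ length (runsWord es) , es) , B ++ reverse ds

decodeBitPair : ℕ → ℕ → List Bit × List Bit → List (⊤ × ℕ) × List Bit
decodeBitPair k N (x , y) = unhalve (proj₂ (toRuns x)) (reverse (drop (N ∸ k) y)) , take (N ∸ k) y

encodeRunPair-valid : ∀ {k N} c → IsRunPair k N c → IsBitPair k N (encodeRunPair N c)
encodeRunPair-valid {k} {N} (zs , B) (|zs|≡k , |B|+k≡N , sum≡N) =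
  trans (length-fromRuns pad es) (m∸n+n≡m fits) ,
  trans (length-++ B) (trans (cong (length B +_) (trans (length-reverse ds) |ds|≡k)) |B|+k≡N) ,
  trans (ones-fromRuns pad es) (trans |es|≡|zs| |zs|≡k) ,
  weight
  where
  es : List (⊤ × ℕ)
  es = proj₁ (halve zs)
  ds : List Bit
  ds = proj₂ (halve zs)
  pad : ℕ
  pad = N ∸ length (runsWord es)
  |es|≡|zs| : length es ≡ length zs
  |es|≡|zs| = proj₁ (length-halve zs)
  |ds|≡k : length ds ≡ k
  |ds|≡k = trans (proj₂ (length-halve zs)) |zs|≡k
  weight : 2 * σ (fromRuns (pad , es)) + σ (B ++ reverse ds) ≡ N
  weight = begin
    2 * σ (fromRuns (pad , es)) + σ (B ++ reverse ds)
      ≡⟨ cong₂ (λ s s′ → 2 * s + s′) (σ-fromRuns pad es) (σ-++-reverse B ds) ⟩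
    2 * σ (runsWord es) + (σ B + length ds * ones B + rankSumˡ ∣_∣ ds)
      ≡⟨ cong (λ m → 2 * σ (runsWord es) + (σ B + m * ones B + rankSumˡ ∣_∣ ds)) |ds|≡k ⟩
    2 * σ (runsWord es) + (σ B + k * ones B + rankSumˡ ∣_∣ ds)
      ≡⟨ rearrange (σ (runsWord es)) (σ B) (k * ones B) (rankSumˡ ∣_∣ ds) ⟩
    2 * σ (runsWord es) + rankSumˡ ∣_∣ ds + σ B + k * ones B
      ≡⟨ cong (λ s → s + σ B + k * ones B) (sym (overlinedSum-runsWord-halve zs)) ⟩
    overlinedSum (runsWord zs) + σ B + k * ones B
      ≡⟨ sum≡N ⟩
    N ∎
    where
    open ≡-Reasoning
    rearrange : ∀ s b c r → 2 * s + (b + c + r) ≡ 2 * s + r + b + c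
    rearrange = solve-∀
  fits : length (runsWord es) ≤ N
  fits = begin
    length (runsWord es)                          ≤⟨ length-runsWord≤σ es ⟩
    σ (runsWord es)                               ≤⟨ m≤m*n (σ (runsWord es)) 2 ⟩
    σ (runsWord es) * 2                           ≡⟨ *-comm (σ (runsWord es)) 2 ⟩
    2 * σ (runsWord es)                           ≤⟨ m≤m+n _ _ ⟩
    2 * σ (runsWord es) + rankSumˡ ∣_∣ ds         ≡⟨ sym (overlinedSum-runsWord-halve zs) ⟩
    overlinedSum (runsWord zs)                    ≤⟨ m≤m+n _ _ ⟩
    overlinedSum (runsWord zs) + σ B              ≤⟨ m≤m+n _ _ ⟩
    overlinedSum (runsWord zs) + σ B + k * ones B ≡⟨ sum≡N ⟩
    N                                             ∎
    where open ≤-Reasoning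

module _ {k N} (x y : List Bit) (valid : IsBitPair k N (x , y)) where
  private
    |x|≡N : length x ≡ N
    |x|≡N = proj₁ valid
    |y|≡N : length y ≡ N
    |y|≡N = proj₁ (proj₂ valid)
    ones≡k : ones x ≡ k
    ones≡k = proj₁ (proj₂ (proj₂ valid))
    sum≡N : 2 * σ x + σ y ≡ N
    sum≡N = proj₂ (proj₂ (proj₂ valid))
    t : ℕ
    t = proj₁ (toRuns x)
    es : List (⊤ × ℕ)
    es = proj₂ (toRuns x)
    y₁ y₂ ds : List Bit
    y₁ = take (N ∸ k) y
    y₂ = drop (N ∸ k) y
    ds = reverse y₂
    k≤N : k ≤ N
    k≤N = subst₂ _≤_ ones≡k |x|≡N (ones≤length x)
    |es|≡k : length es ≡ k
    |es|≡k = trans (sym (ones-fromRuns t es)) (trans (cong ones (fromRuns-toRuns x)) ones≡k)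
    |ds|≡k : length ds ≡ k
    |ds|≡k = trans (length-reverse y₂)
                   (trans (length-drop (N ∸ k) y) (trans (cong (_∸ (N ∸ k)) |y|≡N) (m∸[m∸n]≡n k≤N)))
    |y₁|≡N∸k : length y₁ ≡ N ∸ k
    |y₁|≡N∸k = trans (length-take (N ∸ k) y) (trans (cong ((N ∸ k) ⊓_) |y|≡N) (m≤n⇒m⊓n≡m (m∸n≤m N k)))
    y≡y₁++reverse-ds : y ≡ y₁ ++ reverse ds
    y≡y₁++reverse-ds = trans (sym (take++drop≡id (N ∸ k) y)) (cong (y₁ ++_) (sym (reverse-involutive y₂)))
    σx : σ x ≡ σ (runsWord es)
    σx = trans (cong σ (sym (fromRuns-toRuns x))) (σ-fromRuns t es)
    σy : σ y ≡ σ y₁ + k * ones y₁ + rankSumˡ ∣_∣ ds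
    σy = trans (cong σ y≡y₁++reverse-ds)
               (trans (σ-++-reverse y₁ ds) (cong (λ m → σ y₁ + m * ones y₁ + rankSumˡ ∣_∣ ds) |ds|≡k))

  decodeBitPair-valid : IsRunPair k N (decodeBitPair k N (x , y))
  decodeBitPair-valid =
    trans (length-unhalve es ds (trans |es|≡k (sym |ds|≡k))) |es|≡k ,
    trans (cong (_+ k) |y₁|≡N∸k) (m∸n+n≡m k≤N) ,
    (begin
      overlinedSum (runsWord (unhalve es ds)) + σ y₁ + k * ones y₁
        ≡⟨ cong (λ s → s + σ y₁ + k * ones y₁) (overlinedSum-runsWord-unhalve es ds (trans |es|≡k (sym |ds|≡k))) ⟩
      2 * σ (runsWord es) + rankSumˡ ∣_∣ ds + σ y₁ + k * ones y₁
        ≡⟨ rearrange (σ (runsWord es)) (rankSumˡ ∣_∣ ds) (σ y₁) (k * ones y₁) ⟩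
      2 * σ (runsWord es) + (σ y₁ + k * ones y₁ + rankSumˡ ∣_∣ ds)
        ≡⟨ cong₂ (λ s s′ → 2 * s + s′) σx σy ⟨
      2 * σ x + σ y
        ≡⟨ sum≡N ⟩
      N ∎)
    where
    open ≡-Reasoning
    rearrange : ∀ s r b c → 2 * s + r + b + c ≡ 2 * s + (b + c + r)
    rearrange = solve-∀

  encodeRunPair∘decodeBitPair : encodeRunPair N (decodeBitPair k N (x , y)) ≡ (x , y)
  encodeRunPair∘decodeBitPair = begin
    encodeRunPair N (unhalve es ds , y₁)
      ≡⟨ cong (λ (es , ds) → fromRuns (N ∸ length (runsWord es) , es) , y₁ ++ reverse ds)
              (halve-unhalve es ds (trans |es|≡k (sym |ds|≡k))) ⟩
    fromRuns (N ∸ length (runsWord es) , es) , y₁ ++ reverse ds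
      ≡⟨ cong₂ _,_ (fromRuns-toRuns-padded x
                      (trans (sym (length-fromRuns t es)) (trans (cong length (fromRuns-toRuns x)) |x|≡N)))
                   (sym y≡y₁++reverse-ds) ⟩
    x , y ∎
    where open ≡-Reasoning

decodeBitPair∘encodeRunPair : ∀ {k N} c → IsRunPair k N c → decodeBitPair k N (encodeRunPair N c) ≡ c
decodeBitPair∘encodeRunPair {k} {N} (zs , B) (_ , |B|+k≡N , _) = begin
  decodeBitPair k N (encodeRunPair N (zs , B))
    ≡⟨ cong (λ m → unhalve es′ (reverse (drop m (B ++ reverse ds))) , take m (B ++ reverse ds)) N∸k≡|B| ⟩
  unhalve es′ (reverse (drop (length B) (B ++ reverse ds))) , take (length B) (B ++ reverse ds)
    ≡⟨ cong₂ (λ es′ ds′ → unhalve es′ (reverse ds′) , take (length B) (B ++ reverse ds))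
             (cong proj₂ (toRuns-fromRuns (N ∸ length (runsWord es)) es)) (drop-length-++ B (reverse ds)) ⟩
  unhalve es (reverse (reverse ds)) , take (length B) (B ++ reverse ds)
    ≡⟨ cong₂ _,_ (trans (cong (unhalve es) (reverse-involutive ds)) (unhalve-halve zs))
                 (take-length-++ B (reverse ds)) ⟩
  zs , B ∎
  where
  open ≡-Reasoning
  es : List (⊤ × ℕ)
  es = proj₁ (halve zs)
  ds : List Bit
  ds = proj₂ (halve zs)
  es′ : List (⊤ × ℕ)
  es′ = proj₂ (toRuns (fromRuns (N ∸ length (runsWord es) , es)))
  N∸k≡|B| : N ∸ k ≡ length B
  N∸k≡|B| = trans (cong (_∸ k) (sym |B|+k≡N)) (m+n∸n≡m (length B) k)

RunPairs↔BitPairs : ∀ {k N} → RunPairs k N ↔ BitPairs k N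
RunPairs↔BitPairs {k} {N} = subset-↔ (×-irrelevant ≡-irrelevant ≡×≡-irrelevant)
  (×-irrelevant ≡-irrelevant (×-irrelevant ≡-irrelevant ≡×≡-irrelevant))
  (encodeRunPair N) (decodeBitPair k N)
  (λ {c} → encodeRunPair-valid c) (λ {(x , y)} → decodeBitPair-valid x y)
  (λ {(x , y)} → encodeRunPair∘decodeBitPair x y) (λ {c} → decodeBitPair∘encodeRunPair c)

Card-productSide : ∀ k N → Card (BitPairs k N) (productSide k N)
Card-productSide k N =
  Card-↔ reassociate
    (Counts-⊗ (Counts-prodBelow ∣_∣ double counts-x N) (Counts-prodBelow (const 0) ∣_∣ counts-y N) k N)
  where
  double : Bit → ℕ
  double b = 2 * ∣ b ∣
  counts-x : ∀ i → Counts (one ⊕ mono 1 (2 * suc i)) (Graded Bit ∣_∣ (λ b → suc i * double b))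
  counts-x i = Counts-1+mono ∣_∣ (λ b → suc i * double b) refl (*-zeroʳ (suc i)) refl (*-comm (suc i) 2)
  counts-y : ∀ i → Counts (one ⊕ mono 0 (suc i)) (Graded Bit (const 0) (λ b → suc i * ∣ b ∣))
  counts-y i = Counts-1+mono (const 0) (λ b → suc i * ∣ b ∣) refl (*-zeroʳ (suc i)) refl (*-identityʳ (suc i))
  reassociate : Graded (ListOfLength Bit N × ListOfLength Bit N) (λ ((x , _) , (y , _)) → ones x + total (const 0) y)
                                                               (λ ((x , _) , (y , _)) → rankSumʳ double x + σ y) k N
                ↔ BitPairs k N
  reassociate = mk↔ₛ′
    (λ (((x , |x|≡N) , (y , |y|≡N)) , ones≡k , sum≡N) →
       (x , y) , |x|≡N , |y|≡N ,
       trans (sym (trans (cong (ones x +_) (total-zero y)) (+-identityʳ _))) ones≡k ,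
       trans (cong (_+ σ y) (sym (rankSumʳ-scale 2 ∣_∣ x))) sum≡N)
    (λ ((x , y) , |x|≡N , |y|≡N , ones≡k , sum≡N) →
       ((x , |x|≡N) , (y , |y|≡N)) ,
       trans (trans (cong (ones x +_) (total-zero y)) (+-identityʳ _)) ones≡k ,
       trans (cong (_+ σ y) (rankSumʳ-scale 2 ∣_∣ x)) sum≡N)
    (λ ((x , y) , _) → subset-≡ (×-irrelevant ≡-irrelevant (×-irrelevant ≡-irrelevant ≡×≡-irrelevant)) refl)
    (λ (((x , _) , (y , _)) , _) → cong₂ (λ (|x|≡N , |y|≡N) w → ((x , |x|≡N) , (y , |y|≡N)) , w)
                                        (≡×≡-irrelevant _ _) (≡×≡-irrelevant _ _))

GapSequences↔BitPairs : ∀ {k N} → GapSequences k N ↔ BitPairs k N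
GapSequences↔BitPairs {k} {N} = begin
  GapSequences k N ↔⟨ GapSequences↔TileWords ⟩
  TileWords k N    ↔⟨ TileWords↔SplitPairs ⟩
  SplitPairs k N   ↔⟨ SplitPairs↔RunPairs ⟩
  RunPairs k N     ↔⟨ RunPairs↔BitPairs ⟩
  BitPairs k N     ∎
  where open EquationalReasoning

Card-SOP-middleSeries : ∀ k N → Card (SOP k N) (middleSeries k N)
Card-SOP-middleSeries k N = Card-↔ (↔-sym SOP↔GapSequences) (Counts-middleSeries k N)

Card-SOP-productSide : ∀ k N → Card (SOP k N) (productSide k N)
Card-SOP-productSide k N = Card-↔ (↔-sym (↔-trans SOP↔GapSequences GapSequences↔BitPairs)) (Card-productSide k N)

-- Not opened above, where +_ would make sections such as (n +_) ambiguous.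
open import Data.Integer using (+_)

theorem4p6 : (k N : ℕ) → Σ ℕ (λ c →
               (Fin c ↔ SOP k N) × (middleSeries k N ≡ + c) × (productSide k N ≡ + c))
theorem4p6 k N =
  let (c , Fin↔SOP , middle≡c) = Card-SOP-middleSeries k N in
  c , Fin↔SOP , middle≡c , trans (Card-unique (Card-SOP-productSide k N) (Card-SOP-middleSeries k N)) middle≡c
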